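{- Let $n,k_1,k_2\ge 0$ with $\ell=n-k_1-k_2\ge 0$. If $G\in\mathcal{U}$, then there is a matrix $G'\in\mathcal{V}$ such that the $\mathbb{Z}_4$-codes generated by (the rows of) $G$ and $G'$ are equivalent.
   Context: $\mathbb{Z}_4=\{0,1,2,3\}$ is the ring of integers modulo $4$; a $\mathbb{Z}_4$-code of length $n$ is a submodule of $\mathbb{Z}_4^n$, and the code generated by a matrix is the $\mathbb{Z}_4$-span of its rows. Two codes are equivalent if $C'=CP$ for a monomial matrix $P$ with nonzero entries in $\{1,-1\}$. Order $\mathbb{Z}_4$ by $0<1<2<3$ and order $\mathbb{Z}_4^m$ lexicographically. $M_{m\times n}(R)$ is the set of $m\times n$ matrices with entries in $R$. For $T\subseteq M_{m\times n}(\mathbb{Z}_4)$, $P_{row}(T)$ is the set of matrices in $T$ whose rows $a_1,\dots,a_m$ satisfy $a_i\le a_j$ whenever $i\le j$, and $P_{col}(T)$ is the set of matrices in $T$ whose columns $b_1,\dots,b_n$ satisfy $b_i^T\le b_j^T$ whenever $i\le j$. For a $k_1\times k_2$ $(0,1)$-matrix $A$, a $k_1\times \ell$ $\mathbb{Z}_4$-matrix $B$ and a $k_2\times\ell$ $(0,1)$-matrix $D$, let $G(A,B,D)=\begin{pmatrix} I_{k_1}&A&B\\ O&2I_{k_2}&2D\end{pmatrix}$. Let $\mathcal{S}=\{G(A,B,D)\mid A\in M_{k_1\times k_2}(\{0,1\}),B\in M_{k_1\times\ell}(\mathbb{Z}_4),D\in M_{k_2\times\ell}(\{0,1\})\}$,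 $\mathcal{T}=\{G(A,B,D)\in\mathcal{S}\mid A\in P_{row}(M_{k_1\times k_2}(\{0,1\}))\}$, $\mathcal{U}=\{G(A,B,D)\in\mathcal{T}\mid B\in\mathcal{B}\}$, where $\mathcal{B}$ is the set consisting of all $k_1\times\ell$ matrices with entries in $\{0,2\}$ together with all $k_1\times\ell$ $\mathbb{Z}_4$-matrices $B$ such that, for the smallest $i$ for which the $i$-th row of $B$ contains an entry not in $\{0,2\}$, that row contains only entries in $\{0,1,2\}$; and $\mathcal{V}=\{G(A,B,D)\in\mathcal{U}\mid \begin{pmatrix}B\\2D\end{pmatrix}\in P_{col}(M_{(k_1+k_2)\times\ell}(\mathbb{Z}_4))\}$. -}

module Defs where

open import Data.Nat as ℕ using (ℕ; zero; suc)
open import Data.Nat.DivMod using (_mod_)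
open import Data.Fin using (Fin; zero; suc; toℕ; splitAt; _<_; _≤_; _≟_)
open import Data.Fin.Permutation using (Permutation′; _⟨$⟩ʳ_)
open import Data.Sum using (_⊎_; inj₁; inj₂)
open import Data.Product using (Σ; ∃; _×_; _,_)
open import Data.Unit using (⊤)
open import Relation.Nullary using (¬_; yes; no)
open import Relation.Binary.PropositionalEquality using (_≡_; _≢_)
open import Function.Bundles using (_⇔_)

-- The ring Z4 = {0,1,2,3}, ordered 0 < 1 < 2 < 3 (the order of Fin 4)

Z4 : Set
Z4 = Fin 4

pattern ₀ = zero
pattern ₁ = suc zero
pattern ₂ = suc (suc zero)
pattern ₃ = suc (suc (suc zero))

infixl 6 _+₄_
infixl 7 _*₄_

_+₄_ : Z4 → Z4 → Z4
a +₄ b = (toℕ a ℕ.+ toℕ b) mod 4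

_*₄_ : Z4 → Z4 → Z4
a *₄ b = (toℕ a ℕ.* toℕ b) mod 4

Vec4 : ℕ → Set
Vec4 m = Fin m → Z4

Mat : ℕ → ℕ → Set
Mat m n = Fin m → Fin n → Z4

Σ₄ : ∀ {m} → (Fin m → Z4) → Z4
Σ₄ {zero}  f = zero
Σ₄ {suc m} f = f zero +₄ Σ₄ (λ i → f (suc i))

_≈ᵥ_ : ∀ {n} → Vec4 n → Vec4 n → Set
x ≈ᵥ y = ∀ j → x j ≡ y j

_·ₘ_ : ∀ {m n} → Vec4 m → Mat m n → Vec4 n
(x ·ₘ P) j = Σ₄ (λ i → x i *₄ P i j)

-- Codes (submodules of Z4^n), viewed as predicates on Z4^n

Code : ℕ → Set₁
Code n = Vec4 n → Set

generated : ∀ {m n} → Mat m n → Code n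
generated {m} G v = Σ (Vec4 m) λ c → v ≈ᵥ (c ·ₘ G)

-- monomial matrices whose nonzero entries are in {1,-1} = {1,3}
IsMonomial : ∀ {n} → Mat n n → Set
IsMonomial {n} P =
  Σ (Permutation′ n) λ σ → Σ (Vec4 n) λ s →
    (∀ i → s i ≡ ₁ ⊎ s i ≡ ₃) ×
    (∀ i j → (σ ⟨$⟩ʳ i ≡ j → P i j ≡ s i) × (σ ⟨$⟩ʳ i ≢ j → P i j ≡ ₀))

_≡CP_ : ∀ {n} → Code n → Code n × Mat n n → Set
C' ≡CP (C , P) = ∀ y → C' y ⇔ (∃ λ x → C x × y ≈ᵥ (x ·ₘ P))

Equivalent : ∀ {n} → Code n → Code n → Set
Equivalent {n} C C' = Σ (Mat n n) λ P → IsMonomial P × C' ≡CP (C , P)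

_≤lex_ : ∀ {m} → Vec4 m → Vec4 m → Set
_≤lex_ {zero}  a b = ⊤
_≤lex_ {suc m} a b = (a zero < b zero) ⊎
                     ((a zero ≡ b zero) × ((λ i → a (suc i)) ≤lex (λ i → b (suc i))))

InProw : ∀ {m n} → Mat m n → Set
InProw M = ∀ i j → i ≤ j → M i ≤lex M j

InPcol : ∀ {m n} → Mat m n → Set
InPcol M = ∀ i j → i ≤ j → (λ r → M r i) ≤lex (λ r → M r j)

Is01 : ∀ {m n} → Mat m n → Set
Is01 M = ∀ i j → M i j ≡ ₀ ⊎ M i j ≡ ₁

In02 : Z4 → Set
In02 a = a ≡ ₀ ⊎ a ≡ ₂

Inℬ : ∀ {m n} → Mat m n → Set
Inℬ {m} {n} B =
  (∀ i j → In02 (B i j)) ⊎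
  (Σ (Fin m) λ i →
      (∃ λ j → ¬ In02 (B i j)) ×
      (∀ i' → i' < i → ∀ j → In02 (B i' j)) ×
      (∀ j → B i j ≢ ₃))

-- G(A,B,D) = ( I_{k1}  A      B  )
--            ( O       2I_{k2} 2D )

δ : ∀ {k} → Fin k → Fin k → Z4
δ i j with i ≟ j
... | yes _ = ₁
... | no  _ = ₀

Gmat : ∀ {k₁ k₂ ℓ} → Mat k₁ k₂ → Mat k₁ ℓ → Mat k₂ ℓ →
       Mat (k₁ ℕ.+ k₂) (k₁ ℕ.+ (k₂ ℕ.+ ℓ))
Gmat {k₁} {k₂} {ℓ} A B D i j with splitAt k₁ i | splitAt k₁ j
... | inj₁ r | inj₁ c = δ r c
... | inj₁ r | inj₂ c with splitAt k₂ c
...   | inj₁ c' = A r c'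
...   | inj₂ c' = B r c'
Gmat {k₁} {k₂} {ℓ} A B D i j | inj₂ r | inj₁ c = ₀
Gmat {k₁} {k₂} {ℓ} A B D i j | inj₂ r | inj₂ c with splitAt k₂ c
...   | inj₁ c' = ₂ *₄ δ r c'
...   | inj₂ c' = ₂ *₄ D r c'

stack2 : ∀ {k₁ k₂ ℓ} → Mat k₁ ℓ → Mat k₂ ℓ → Mat (k₁ ℕ.+ k₂) ℓ
stack2 {k₁} B D i j with splitAt k₁ i
... | inj₁ r = B r j
... | inj₂ r = ₂ *₄ D r j

-- the sets 𝒮 ⊇ 𝒯 ⊇ 𝒰 ⊇ 𝒱 (as predicates on matrices); n = k₁ + k₂ + ℓ

Eqₘ : ∀ {m n} → Mat m n → Mat m n → Set
Eqₘ G H = ∀ i j → G i j ≡ H i j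

Gmatrix : ℕ → ℕ → ℕ → Set
Gmatrix k₁ k₂ ℓ = Mat (k₁ ℕ.+ k₂) (k₁ ℕ.+ (k₂ ℕ.+ ℓ))

In𝒮 : ∀ k₁ k₂ ℓ → Gmatrix k₁ k₂ ℓ → Set
In𝒮 k₁ k₂ ℓ G = Σ (Mat k₁ k₂) λ A → Σ (Mat k₁ ℓ) λ B → Σ (Mat k₂ ℓ) λ D →
  Is01 A × Is01 D × Eqₘ G (Gmat A B D)

In𝒯 : ∀ k₁ k₂ ℓ → Gmatrix k₁ k₂ ℓ → Set
In𝒯 k₁ k₂ ℓ G = Σ (Mat k₁ k₂) λ A → Σ (Mat k₁ ℓ) λ B → Σ (Mat k₂ ℓ) λ D →
  Is01 A × Is01 D × InProw A × Eqₘ G (Gmat A B D)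

In𝒰 : ∀ k₁ k₂ ℓ → Gmatrix k₁ k₂ ℓ → Set
In𝒰 k₁ k₂ ℓ G = Σ (Mat k₁ k₂) λ A → Σ (Mat k₁ ℓ) λ B → Σ (Mat k₂ ℓ) λ D →
  Is01 A × Is01 D × InProw A × Inℬ B × Eqₘ G (Gmat A B D)

In𝒱 : ∀ k₁ k₂ ℓ → Gmatrix k₁ k₂ ℓ → Set
In𝒱 k₁ k₂ ℓ G = Σ (Mat k₁ k₂) λ A → Σ (Mat k₁ ℓ) λ B → Σ (Mat k₂ ℓ) λ D →
  Is01 A × Is01 D × InProw A × Inℬ B × InPcol (stack2 B D) × Eqₘ G (Gmat A B D)

-- Permuting coordinates is multiplication by a permutation matrix,
-- which is monomial with all nonzero entries 1, so it maps a code to an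
-- equivalent one.  Choose a permutation π of the last ℓ coordinates that
-- sorts the columns of the stacked matrix (B ; 2D) lexicographically, and
-- set G' = G(A, B∘π, D∘π).  Then G' is G with its last ℓ columns permuted;
-- A is untouched, D∘π is still a (0,1)-matrix, B∘π is still in ℬ (the
-- conditions defining ℬ concern whole rows, so they ignore the order of
-- the entries within a row), and (B∘π ; 2D∘π) is in P_col by construction.
module Submission where

open import Defs
open import Data.Nat using (ℕ)
open import Data.Product using (Σ; _×_)
import Data.Nat as ℕ
open import Data.Fin using (Fin; zero; suc; splitAt; _<_; _≤_; _≟_)
open import Data.Fin.Properties using (<-cmp; <-trans; suc-injective)
open import Data.Fin.Permutation
  using (Permutation′; _⟨$⟩ʳ_; _⟨$⟩ˡ_; inverseˡ; inverseʳ; id; flip; _∘ₚ_; lift₀; transpose)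
open import Data.Sum using (_⊎_; inj₁; inj₂)
import Data.Sum as Sum
open import Data.Product using (_,_)
open import Data.Empty using (⊥-elim)
open import Relation.Nullary using (¬_; yes; no)
open import Relation.Binary using (tri<; tri≈; tri>)
open import Relation.Binary.PropositionalEquality
  using (_≡_; _≢_; refl; sym; trans; cong; subst; module ≡-Reasoning)
open import Function.Bundles using (mk⇔)

lex-refl : ∀ {m} (a : Vec4 m) → a ≤lex a
lex-refl {ℕ.zero}  a = _
lex-refl {ℕ.suc m} a = inj₂ (refl , lex-refl (λ i → a (suc i)))

lex-trans : ∀ {m} {a b c : Vec4 m} → a ≤lex b → b ≤lex c → a ≤lex c
lex-trans {ℕ.zero}  _ _ = _
lex-trans {ℕ.suc m}         (inj₁ a<b)       (inj₁ b<c)       = inj₁ (<-trans a<b b<c)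
lex-trans {ℕ.suc m} {a}     (inj₁ a<b)       (inj₂ (b≡c , _)) = inj₁ (subst (a zero <_) b≡c a<b)
lex-trans {ℕ.suc m} {c = c} (inj₂ (a≡b , _)) (inj₁ b<c)       = inj₁ (subst (_< c zero) (sym a≡b) b<c)
lex-trans {ℕ.suc m}         (inj₂ (a≡b , p)) (inj₂ (b≡c , q)) = inj₂ (trans a≡b b≡c , lex-trans p q)

lex-total : ∀ {m} (a b : Vec4 m) → a ≤lex b ⊎ b ≤lex a
lex-total {ℕ.zero}  a b = inj₁ _
lex-total {ℕ.suc m} a b with <-cmp (a zero) (b zero)
... | tri< a<b _ _ = inj₁ (inj₁ a<b)
... | tri> _ _ b<a = inj₂ (inj₁ b<a)
... | tri≈ _ a≡b _ with lex-total (λ i → a (suc i)) (λ i → b (suc i))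
...   | inj₁ p = inj₁ (inj₂ (a≡b , p))
...   | inj₂ p = inj₂ (inj₂ (sym a≡b , p))

lex-resp-≈ᵥ : ∀ {m} {a a' b b' : Vec4 m} → a ≈ᵥ a' → b ≈ᵥ b' → a ≤lex b → a' ≤lex b'
lex-resp-≈ᵥ {ℕ.zero} _ _ _ = _
lex-resp-≈ᵥ {ℕ.suc m} ea eb (inj₁ a<b) rewrite ea zero | eb zero = inj₁ a<b
lex-resp-≈ᵥ {ℕ.suc m} ea eb (inj₂ (a≡b , p)) rewrite ea zero | eb zero =
  inj₂ (a≡b , lex-resp-≈ᵥ (λ i → ea (suc i)) (λ i → eb (suc i)) p)

module SelectionSort {X : Set} (R : X → X → Set)
  (R-refl : ∀ x → R x x)
  (R-trans : ∀ {x y z} → R x y → R y z → R x z)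
  (R-total : ∀ x y → R x y ⊎ R y x) where

  minimum : ∀ {n} (f : Fin (ℕ.suc n) → X) → Σ (Fin (ℕ.suc n)) λ m → ∀ i → R (f m) (f i)
  minimum {ℕ.zero} f = zero , λ { zero → R-refl _ }
  minimum {ℕ.suc n} f with minimum (λ i → f (suc i))
  ... | m , m-least with R-total (f zero) (f (suc m))
  ... | inj₁ r = zero  , λ { zero → R-refl _ ; (suc i) → R-trans r (m-least i) }
  ... | inj₂ r = suc m , λ { zero → r ; (suc i) → m-least i }

  -- Every finite family can be reordered into R-ascending order: move the
  -- minimum to the front, then sort the rest.
  sort : ∀ n (f : Fin n → X) → Σ (Permutation′ n) λ π →
         ∀ i j → i ≤ j → R (f (π ⟨$⟩ʳ i)) (f (π ⟨$⟩ʳ j))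
  sort ℕ.zero f = id , λ ()
  sort (ℕ.suc n) f with minimum f
  ... | m , m-least with sort n (λ i → f (transpose zero m ⟨$⟩ʳ suc i))
  ... | π , sorted = lift₀ π ∘ₚ transpose zero m , ascending
    where
    ascending : ∀ i j → i ≤ j → R (f ((lift₀ π ∘ₚ transpose zero m) ⟨$⟩ʳ i))
                                  (f ((lift₀ π ∘ₚ transpose zero m) ⟨$⟩ʳ j))
    ascending zero    j       _           = m-least _
    ascending (suc i) (suc j) (ℕ.s≤s i≤j) = sorted i j i≤j

+₄-identityˡ : ∀ a → ₀ +₄ a ≡ a
+₄-identityˡ ₀ = refl
+₄-identityˡ ₁ = refl
+₄-identityˡ ₂ = refl
+₄-identityˡ ₃ = refl

+₄-identityʳ : ∀ a → a +₄ ₀ ≡ a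
+₄-identityʳ ₀ = refl
+₄-identityʳ ₁ = refl
+₄-identityʳ ₂ = refl
+₄-identityʳ ₃ = refl

*₄-identityʳ : ∀ a → a *₄ ₁ ≡ a
*₄-identityʳ ₀ = refl
*₄-identityʳ ₁ = refl
*₄-identityʳ ₂ = refl
*₄-identityʳ ₃ = refl

*₄-zeroʳ : ∀ a → a *₄ ₀ ≡ ₀
*₄-zeroʳ ₀ = refl
*₄-zeroʳ ₁ = refl
*₄-zeroʳ ₂ = refl
*₄-zeroʳ ₃ = refl

Σ₄-cong : ∀ {m} {f g : Fin m → Z4} → (∀ i → f i ≡ g i) → Σ₄ f ≡ Σ₄ g
Σ₄-cong {ℕ.zero}  e = refl
Σ₄-cong {ℕ.suc m} e rewrite e zero | Σ₄-cong (λ i → e (suc i)) = refl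

Σ₄-zero : ∀ {m} (f : Fin m → Z4) → (∀ i → f i ≡ ₀) → Σ₄ f ≡ ₀
Σ₄-zero {ℕ.zero}  f e = refl
Σ₄-zero {ℕ.suc m} f e rewrite e zero | Σ₄-zero (λ i → f (suc i)) (λ i → e (suc i)) = refl

Σ₄-single : ∀ {m} (f : Fin m → Z4) i₀ → (∀ i → i ≢ i₀ → f i ≡ ₀) → Σ₄ f ≡ f i₀
Σ₄-single {ℕ.suc m} f zero others
  rewrite Σ₄-zero (λ i → f (suc i)) (λ i → others (suc i) (λ ())) = +₄-identityʳ (f zero)
Σ₄-single {ℕ.suc m} f (suc i₀) others rewrite others zero (λ ()) =
  trans (+₄-identityˡ _)
        (Σ₄-single (λ i → f (suc i)) i₀ (λ i i≢i₀ → others (suc i) (λ e → i≢i₀ (suc-injective e))))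

δ-same : ∀ {k} (j : Fin k) → δ j j ≡ ₁
δ-same j with j ≟ j
... | yes _   = refl
... | no j≢j = ⊥-elim (j≢j refl)

δ-diff : ∀ {k} {i j : Fin k} → i ≢ j → δ i j ≡ ₀
δ-diff {i = i} {j} i≢j with i ≟ j
... | yes i≡j = ⊥-elim (i≢j i≡j)
... | no _    = refl

permMatrix : ∀ {n} → Permutation′ n → Mat n n
permMatrix σ i j = δ (σ ⟨$⟩ʳ i) j

permMatrix-monomial : ∀ {n} (σ : Permutation′ n) → IsMonomial (permMatrix σ)
permMatrix-monomial σ =
  σ , (λ _ → ₁) , (λ _ → inj₁ refl) ,
  λ i j → (λ σi≡j → subst (λ z → δ (σ ⟨$⟩ʳ i) z ≡ ₁) σi≡j (δ-same _)) , δ-diff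

·-permMatrix : ∀ {n} (σ : Permutation′ n) (x : Vec4 n) j → (x ·ₘ permMatrix σ) j ≡ x (σ ⟨$⟩ˡ j)
·-permMatrix σ x j = begin
  Σ₄ (λ i → x i *₄ δ (σ ⟨$⟩ʳ i) j)       ≡⟨ Σ₄-single _ (σ ⟨$⟩ˡ j) other-terms ⟩
  x (σ ⟨$⟩ˡ j) *₄ δ (σ ⟨$⟩ʳ (σ ⟨$⟩ˡ j)) j ≡⟨ cong (λ z → x (σ ⟨$⟩ˡ j) *₄ δ z j) (inverseʳ σ) ⟩
  x (σ ⟨$⟩ˡ j) *₄ δ j j                  ≡⟨ cong (x (σ ⟨$⟩ˡ j) *₄_) (δ-same j) ⟩
  x (σ ⟨$⟩ˡ j) *₄ ₁                      ≡⟨ *₄-identityʳ _ ⟩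
  x (σ ⟨$⟩ˡ j)                           ∎
  where
  open ≡-Reasoning
  other-terms : ∀ i → i ≢ σ ⟨$⟩ˡ j → x i *₄ δ (σ ⟨$⟩ʳ i) j ≡ ₀
  other-terms i i≢ =
    trans (cong (x i *₄_) (δ-diff (λ σi≡j → i≢ (trans (sym (inverseˡ σ)) (cong (σ ⟨$⟩ˡ_) σi≡j)))))
          (*₄-zeroʳ (x i))

-- If N is M with its columns permuted by ρ, then the codes generated by M
-- and N are equivalent, via the permutation matrix of ρ⁻¹.
generated-permuteColumns : ∀ {m n} (M N : Mat m n) (ρ : Permutation′ n) →
  (∀ i j → N i j ≡ M i (ρ ⟨$⟩ʳ j)) → Equivalent (generated M) (generated N)
generated-permuteColumns M N ρ N≡Mρ =
  permMatrix (flip ρ) , permMatrix-monomial (flip ρ) , λ y → mk⇔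
    (λ { (c , y≈cN) → (c ·ₘ M) , (c , λ _ → refl) ,
           λ j → trans (y≈cN j) (trans (cN≡cMρ c j) (sym (·-permMatrix (flip ρ) (c ·ₘ M) j))) })
    (λ { (x , (c , x≈cM) , y≈xP) → c ,
           λ j → trans (y≈xP j) (trans (·-permMatrix (flip ρ) x j)
                   (trans (x≈cM (ρ ⟨$⟩ʳ j)) (sym (cN≡cMρ c j)))) })
  where
  cN≡cMρ : ∀ c j → (c ·ₘ N) j ≡ (c ·ₘ M) (ρ ⟨$⟩ʳ j)
  cN≡cMρ c j = Σ₄-cong (λ i → cong (c i *₄_) (N≡Mρ i j))

liftₖ : ∀ k {X} → Permutation′ X → Permutation′ (k ℕ.+ X)
liftₖ ℕ.zero    π = π
liftₖ (ℕ.suc k) π = lift₀ (liftₖ k π)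

splitAt-liftₖ : ∀ k {X} (π : Permutation′ X) (j : Fin (k ℕ.+ X)) →
  splitAt k (liftₖ k π ⟨$⟩ʳ j) ≡ Sum.map (λ x → x) (π ⟨$⟩ʳ_) (splitAt k j)
splitAt-liftₖ ℕ.zero    π j       = refl
splitAt-liftₖ (ℕ.suc k) π zero    = refl
splitAt-liftₖ (ℕ.suc k) π (suc j) with splitAt k j | splitAt-liftₖ k π j
... | inj₁ _ | e rewrite e = refl
... | inj₂ _ | e rewrite e = refl

permuteColumns : ∀ {m ℓ} → Mat m ℓ → Permutation′ ℓ → Mat m ℓ
permuteColumns M π r c = M r (π ⟨$⟩ʳ c)

Gmat-permuteColumns : ∀ {k₁ k₂ ℓ} (A : Mat k₁ k₂) (B : Mat k₁ ℓ) (D : Mat k₂ ℓ)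
  (π : Permutation′ ℓ) i j →
  Gmat A (permuteColumns B π) (permuteColumns D π) i j ≡ Gmat A B D i (liftₖ k₁ (liftₖ k₂ π) ⟨$⟩ʳ j)
Gmat-permuteColumns {k₁} {k₂} A B D π i j
  with splitAt k₁ i | splitAt k₁ j | splitAt k₁ (liftₖ k₁ (liftₖ k₂ π) ⟨$⟩ʳ j)
     | splitAt-liftₖ k₁ (liftₖ k₂ π) j
... | inj₁ _ | inj₁ _ | _ | refl = refl
... | inj₂ _ | inj₁ _ | _ | refl = refl
... | inj₁ _ | inj₂ c | _ | refl
  with splitAt k₂ c | splitAt k₂ (liftₖ k₂ π ⟨$⟩ʳ c) | splitAt-liftₖ k₂ π c
...   | inj₁ _ | _ | refl = refl
...   | inj₂ _ | _ | refl = refl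
Gmat-permuteColumns {k₁} {k₂} A B D π i j | inj₂ _ | inj₂ c | _ | refl
  with splitAt k₂ c | splitAt k₂ (liftₖ k₂ π ⟨$⟩ʳ c) | splitAt-liftₖ k₂ π c
...   | inj₁ _ | _ | refl = refl
...   | inj₂ _ | _ | refl = refl

stack2-permuteColumns : ∀ {k₁ k₂ ℓ} (B : Mat k₁ ℓ) (D : Mat k₂ ℓ) (π : Permutation′ ℓ) r c →
  stack2 (permuteColumns B π) (permuteColumns D π) r c ≡ stack2 B D r (π ⟨$⟩ʳ c)
stack2-permuteColumns {k₁} B D π r c with splitAt k₁ r
... | inj₁ _ = refl
... | inj₂ _ = refl

-- Membership in ℬ only depends on the rows as multisets of entries.
Inℬ-permuteColumns : ∀ {k₁ ℓ} (B : Mat k₁ ℓ) (π : Permutation′ ℓ) → Inℬ B → Inℬ (permuteColumns B π)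
Inℬ-permuteColumns B π (inj₁ all02) = inj₁ (λ i j → all02 i (π ⟨$⟩ʳ j))
Inℬ-permuteColumns B π (inj₂ (i , (j , Bij∉02) , earlier02 , no3)) =
  inj₂ (i , (π ⟨$⟩ˡ j , subst (λ z → ¬ In02 (B i z)) (sym (inverseʳ π)) Bij∉02) ,
        (λ i' i'<i j' → earlier02 i' i'<i (π ⟨$⟩ʳ j')) , (λ j' → no3 (π ⟨$⟩ʳ j')))

lemma5p3 : (k₁ k₂ ℓ : ℕ) → (G : Gmatrix k₁ k₂ ℓ) → In𝒰 k₁ k₂ ℓ G →
    Σ (Gmatrix k₁ k₂ ℓ) λ G' → In𝒱 k₁ k₂ ℓ G' × Equivalent (generated G) (generated G')
lemma5p3 k₁ k₂ ℓ G (A , B , D , A01 , D01 , A∈Prow , B∈ℬ , G≡GABD) with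
  SelectionSort.sort _≤lex_ lex-refl lex-trans lex-total ℓ (λ c r → stack2 B D r c)
... | π , columnsSorted =
  Gmat A B' D' ,
  (A , B' , D' , A01 , (λ r c → D01 r (π ⟨$⟩ʳ c)) , A∈Prow , Inℬ-permuteColumns B π B∈ℬ ,
   stack-in-Pcol , (λ _ _ → refl)) ,
  generated-permuteColumns G (Gmat A B' D') (liftₖ k₁ (liftₖ k₂ π))
    (λ i j → trans (Gmat-permuteColumns A B D π i j) (sym (G≡GABD i _)))
  where
  B' : Mat k₁ ℓ
  B' = permuteColumns B π
  D' : Mat k₂ ℓ
  D' = permuteColumns D π
  stack-in-Pcol : InPcol (stack2 B' D')
  stack-in-Pcol i j i≤j =
    lex-resp-≈ᵥ (λ r → sym (stack2-permuteColumns B D π r i))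
                (λ r → sym (stack2-permuteColumns B D π r j)) (columnsSorted i j i≤j)
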